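{- In the setting described in the context, let $A\in\mathcal{A}$ be an isolated vertex of $\widehat{H}$ and let $z=z(A)$. Then $N_G(V(A))\setminus V(A)=N_G(z)\setminus V(A)$.
   Context: Let $G$ be a finite simple undirected graph; a chordless cycle is an induced cycle on at least four vertices, and a graph is chordal if it has none. Let $E_I,E_M\subseteq E(G)$ and for $u\in V(G)$ let $N^R_G(u)=\{w\in N_G(u):\{u,w\}\notin E_I\cup E_M\}$. Fix $v\in V(G)$ and a set $B_v\subseteq V(G)\setminus\{v\}$ such that $G\setminus B_v$ is chordal. Let $I$ be an independent set of $G$ with $I\subseteq N^R_G(v)\setminus B_v$. Let $X=N_G(v)\setminus(B_v\cup I)$, let $H=G\setminus(\{v\}\cup B_v\cup X)$, and let $\mathcal{A}$ be the set of connected components of $H$ that contain at least one vertex of $I$. Each $A\in\mathcal{A}$ contains exactly one vertex of $I$, denoted $z(A)$. For a vertex set $U$, $N_G(U)=\bigcup_{u\in U}N_G(u)$. Let $B_c=B_v\cap N_G(v)$ and $B_f=B_v\setminus B_c$. The bipartite graph $\widehat{H}$ has vertex set $\mathcal{A}\cup B_v$ (each component $A$ is a single vertex); for $b\in B_c$ and $A\in\mathcal{A}$, $\{b,A\}\in E(\widehat{H})$ iff $b\in N_G(V(A))\setminus N_G(z(A))$; for $b\in B_f$ and $A\in\mathcal{A}$, $\{b,A\}\in E(\widehat{H})$ iff $b\in N_G(V(A))$. -}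

module Defs where

open import Data.Nat using (ℕ; zero; suc; _≤_)
open import Data.Fin using (Fin; toℕ)
open import Data.Fin.Subset using (Subset; _∈_; _∉_; ∁)
open import Data.Product using (Σ; ∃; _×_; _,_)
open import Data.Sum using (_⊎_)
open import Relation.Nullary using (¬_)
open import Relation.Binary.PropositionalEquality using (_≡_)
open import Relation.Binary.Core using (Rel)
open import Relation.Binary.Definitions using (Decidable; Symmetric)
open import Function.Definitions using (Injective)

InEdgeSet : ∀ {n} → Rel (Fin n) _ → Fin n → Fin n → Set
InEdgeSet E u w = E u w ⊎ E w u

record Graph (n : ℕ) : Set₁ where
  field
    Adj    : Fin n → Fin n → Set
    adj?   : Decidable Adj
    sym    : Symmetric Adj
    irrefl : ∀ x → ¬ Adj x x
open Graph public

module _ {n : ℕ} (G : Graph n) where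

  CycNext : (k : ℕ) → Fin k → Fin k → Set
  CycNext k i j = (suc (toℕ i) ≡ toℕ j) ⊎ ((suc (toℕ i) ≡ k) × (toℕ j ≡ 0))

  ChordlessCycleIn : Subset n → Set
  ChordlessCycleIn U =
    Σ ℕ λ k → (4 ≤ k) × Σ (Fin k → Fin n) λ f →
      Injective _≡_ _≡_ f
      × (∀ i → f i ∈ U)
      × (∀ i j → CycNext k i j → Adj G (f i) (f j))
      × (∀ i j → Adj G (f i) (f j) → CycNext k i j ⊎ CycNext k j i)

  ChordalOn : Subset n → Set
  ChordalOn U = ¬ ChordlessCycleIn U

  ChordalMinus : Subset n → Set
  ChordalMinus S = ChordalOn (∁ S)

  data WalkIn (W : Fin n → Set) : Fin n → Fin n → Set where
    here : ∀ {x} → W x → WalkIn W x x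
    step : ∀ {x y z} → W x → Adj G x y → WalkIn W y z → WalkIn W x z

  IsComponent : (Fin n → Set) → Subset n → Set
  IsComponent W C =
    (∃ λ u → u ∈ C)
    × (∀ u → u ∈ C → W u)
    × (∀ x y → x ∈ C → y ∈ C → WalkIn W x y)
    × (∀ x y → x ∈ C → W y → Adj G x y → y ∈ C)

  NbhdSet : Subset n → Fin n → Set
  NbhdSet U w = ∃ λ u → u ∈ U × Adj G u w

  NR : (EI EM : Fin n → Fin n → Set) → Fin n → Fin n → Set
  NR EI EM u w = Adj G u w × ¬ InEdgeSet EI u w × ¬ InEdgeSet EM u w

  Xset : Fin n → Subset n → Subset n → Fin n → Set
  Xset v B I w = Adj G v w × w ∉ B × w ∉ I

  Hset : Fin n → Subset n → Subset n → Fin n → Set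
  Hset v B I w = ¬ (w ≡ v) × w ∉ B × ¬ Xset v B I w

  -- {b, A} is an edge of the bipartite graph Ĥ (A the component with z(A) = z)
  HatEdge : Fin n → Subset n → Fin n → Subset n → Fin n → Set
  HatEdge v B z A b =
    (b ∈ B × Adj G v b × NbhdSet A b × ¬ Adj G z b)
    ⊎ (b ∈ B × ¬ Adj G v b × NbhdSet A b)

  Independent : Subset n → Set
  Independent I = ∀ x y → x ∈ I → y ∈ I → ¬ Adj G x y

-- The inclusion N(z) ∖ A ⊆ N(A) ∖ A is trivial.  Conversely let w ∉ A
-- have a neighbour a ∈ A, and suppose w ≁ z.  If w ∈ B, the pair {w, A} is an edge
-- of Ĥ whether w ∈ B_c or w ∈ B_f, contradicting isolation.  Otherwise w ∈ X (if w
-- were in H it would lie in the component A).  Both v ~ w and v ~ z, and a shortest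
-- path from w to z through a and A is induced; its inner vertices are not
-- neighbours of v, since a neighbour of v inside A lies in I, and z is the only
-- vertex of I in A (proved by the same argument applied to a shortest path from z
-- to another vertex of I in A).  Closing the path with v gives a hole (a chordless
-- cycle of length at least 4) avoiding B, contradicting the chordality of G ∖ B.
module Submission where

open import Defs hiding (sym)
open import Data.Nat using (ℕ; zero; suc; _+_; _≤_; _<_; _≤?_; z≤n; s≤s; z<s)
open import Data.Nat.Properties
open import Data.Nat.Induction using (<-rec)
open import Algebra.Properties.CommutativeSemigroup +-commutativeSemigroup using (xy∙z≈xz∙y)
open import Data.Fin using (Fin; toℕ)
open import Data.Fin.Properties using (toℕ<n; toℕ-injective) renaming (_≟_ to _≟ᶠ_)
open import Data.Fin.Subset using (Subset; _∈_; _∉_)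
open import Data.Fin.Subset.Properties using (x∉p⇒x∈∁p; _∈?_)
open import Data.Product using (∃-syntax; _×_; _,_; proj₁; proj₂)
open import Data.Sum using (_⊎_; inj₁; inj₂; swap) renaming (map to ⊎-map)
open import Data.Empty using (⊥)
open import Function using (_∘_)
open import Relation.Nullary using (¬_; Dec; yes; no; contradiction)
open import Relation.Nullary.Decidable using (decidable-stable)
open import Relation.Binary.PropositionalEquality
  using (_≡_; _≢_; refl; sym; trans; cong; subst; subst₂)
open import Relation.Binary using (tri<; tri≈; tri>)

private
  variable
    i j k m : ℕ

-- Finite sequences g 0, …, g m, encoded as functions on ℕ together with a length.
module _ {V : Set} where

  Steps : (V → V → Set) → (ℕ → V) → ℕ → Set
  Steps R g m = ∀ i → i < m → R (g i) (g (suc i))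

  Within : (V → Set) → (ℕ → V) → ℕ → Set
  Within P g m = ∀ i → i ≤ m → P (g i)

  Avoids : (V → Set) → (ℕ → V) → ℕ → Set
  Avoids T g m = ∀ i → i < m → ¬ T (g i)

  record Route (R : V → V → Set) (W : V → Set) (s : V) (T : V → Set) (m : ℕ) : Set where
    field
      vertex : ℕ → V
      source : vertex 0 ≡ s
      target : T (vertex m)
      inside : Within W vertex m
      steps  : Steps R vertex m
  open Route public

  bypass : (ℕ → V) → ℕ → ℕ → ℕ → V
  bypass g i d k with k ≤? i
  ... | yes _ = g k
  ... | no  _ = g (k + d)

  bypass-≤ : ∀ (g : ℕ → V) i d → k ≤ i → bypass g i d k ≡ g k
  bypass-≤ {k} g i d k≤i with k ≤? i
  ... | yes _   = refl
  ... | no  k≰i = contradiction k≤i k≰i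

  bypass-> : ∀ (g : ℕ → V) i d → i < k → bypass g i d k ≡ g (k + d)
  bypass-> {k} g i d i<k with k ≤? i
  ... | yes k≤i = contradiction k≤i (<⇒≱ i<k)
  ... | no  _   = refl

  module _ {R : V → V → Set} {W : V → Set} {s : V} {T : V → Set} where

    Route-map : ∀ {R′ : V → V → Set} → (∀ {x y} → R x y → R′ x y)
              → Route R W s T m → Route R′ W s T m
    Route-map f p = record
      { vertex = vertex p ; source = source p ; target = target p
      ; inside = inside p ; steps = λ i i<m → f (steps p i i<m) }

    Route-cons : ∀ {x} → W x → R x s → Route R W s T m → Route R W x T (suc m)
    Route-cons {x = x} x∈W x-s p = record
      { vertex = λ { zero → x ; (suc i) → vertex p i }
      ; source = refl
      ; target = target p
      ; inside = λ { zero _ → x∈W ; (suc i) i<m → inside p i (≤-pred i<m) }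
      ; steps  = λ { zero _ → subst (R x) (sym (source p)) x-s
                   ; (suc i) i<m → steps p i (≤-pred i<m) } }

    Route-prefix : (p : Route R W s T m) → i ≤ m → T (vertex p i) → Route R W s T i
    Route-prefix p i≤m i∈T = record
      { vertex = vertex p ; source = source p ; target = i∈T
      ; inside = λ k k≤i → inside p k (≤-trans k≤i i≤m)
      ; steps  = λ k k<i → steps p k (<-≤-trans k<i i≤m) }

    -- Cuts out the d vertices strictly between the ends of the chord i ~ i + 1 + d.
    Route-bypass : ∀ {d r} (p : Route R W s T m) → m ≡ suc i + r + d
                 → R (vertex p i) (vertex p (suc i + d)) → Route R W s T (suc i + r)
    Route-bypass {i = i} {d} {r} p refl chord = record
      { vertex = bypass g i d
      ; source = trans (bypass-≤ g i d z≤n) (source p)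
      ; target = subst T (sym (bypass-> g i d (s≤s (m≤m+n i r)))) (target p)
      ; inside = inside′
      ; steps  = steps′ }
      where
      g : ℕ → V
      g = vertex p

      inside′ : Within W (bypass g i d) (suc i + r)
      inside′ k k≤ with k ≤? i
      ... | yes _ = inside p k (≤-trans k≤ (m≤m+n _ d))
      ... | no  _ = inside p (k + d) (+-monoˡ-≤ d k≤)

      steps′ : Steps R (bypass g i d) (suc i + r)
      steps′ k k< with <-cmp k i
      ... | tri< k<i _ _ = subst₂ R (sym (bypass-≤ g i d (<⇒≤ k<i))) (sym (bypass-≤ g i d k<i))
                                  (steps p k (<-≤-trans k< (m≤m+n _ d)))
      ... | tri≈ _ refl _ = subst₂ R (sym (bypass-≤ g i d ≤-refl)) (sym (bypass-> g i d ≤-refl)) chord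
      ... | tri> _ _ i<k = subst₂ R (sym (bypass-> g i d i<k)) (sym (bypass-> g i d (m<n⇒m<1+n i<k)))
                                  (steps p (k + d) (+-monoˡ-< d k<))

module _ {n : ℕ} (G : Graph n) where

  Adj⁼ : Fin n → Fin n → Set
  Adj⁼ x y = x ≡ y ⊎ Adj G x y

  Chordless : (ℕ → Fin n) → ℕ → Set
  Chordless g m = ∀ i j → suc i < j → j ≤ m → ¬ Adj⁼ (g i) (g j)

  InducedPath : (ℕ → Fin n) → ℕ → Set
  InducedPath g m = Steps (Adj G) g m × Chordless g m

  chordless-consecutive : ∀ {g} → Chordless g m → i < j → j ≤ m → Adj⁼ (g i) (g j) → suc i ≡ j
  chordless-consecutive chordless i<j j≤m i~j with m≤n⇒m<n∨m≡n i<j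
  ... | inj₁ 1+i<j = contradiction i~j (chordless _ _ 1+i<j j≤m)
  ... | inj₂ 1+i≡j = 1+i≡j

  inducedPath-no-revisit : ∀ {g} → InducedPath g m → i < j → j ≤ m → g i ≢ g j
  inducedPath-no-revisit {i = i} {g = g} (steps , chordless) i<j j≤m gi≡gj
    with chordless-consecutive chordless i<j j≤m (inj₁ gi≡gj)
  ... | refl = irrefl G (g i) (subst (Adj G (g i)) (sym gi≡gj) (steps i j≤m))

  inducedPath-injective : ∀ {g} → InducedPath g m → i ≤ m → j ≤ m → g i ≡ g j → i ≡ j
  inducedPath-injective {i = i} {j} path i≤m j≤m gi≡gj with <-cmp i j
  ... | tri< i<j _ _ = contradiction gi≡gj (inducedPath-no-revisit path i<j j≤m)
  ... | tri≈ _ i≡j _ = i≡j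
  ... | tri> _ _ j<i = contradiction (sym gi≡gj) (inducedPath-no-revisit path j<i i≤m)

  inducedPath-adj : ∀ {g} → InducedPath g m → i ≤ m → j ≤ m → Adj G (g i) (g j)
                  → suc i ≡ j ⊎ suc j ≡ i
  inducedPath-adj {i = i} {j} (_ , chordless) i≤m j≤m gi~gj with <-cmp i j
  ... | tri< i<j _ _ = inj₁ (chordless-consecutive chordless i<j j≤m (inj₂ gi~gj))
  ... | tri≈ _ refl _ = contradiction gi~gj (irrefl G _)
  ... | tri> _ _ j<i = inj₂ (chordless-consecutive chordless j<i i≤m (inj₂ (Graph.sym G gi~gj)))

  distant-ends⇒2≤length : ∀ {g} → Steps (Adj G) g m → ¬ Adj⁼ (g 0) (g m) → 2 ≤ m
  distant-ends⇒2≤length {zero}          _     distant = contradiction (inj₁ refl) distant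
  distant-ends⇒2≤length {suc zero}      steps distant = contradiction (inj₂ (steps 0 z<s)) distant
  distant-ends⇒2≤length {suc (suc _)}   _     _       = s≤s (s≤s z≤n)

  -- The hole lists the path at indices 0 … m and the apex y at index m + 1.
  module _ {C : Subset n} {y : Fin n} {g : ℕ → Fin n} {m : ℕ}
           (path : InducedPath g m) (distant : ¬ Adj⁼ (g 0) (g m))
           (g∈C : Within (_∈ C) g m) (y∈C : y ∈ C) (y∉g : Within (y ≢_) g m)
           (y~first : Adj G y (g 0)) (y~last : Adj G y (g m))
           (y≁inner : ∀ i → 0 < i → i < m → ¬ Adj G y (g i)) where

    private
      Next : ℕ → ℕ → Set
      Next i j = suc i ≡ j ⊎ (suc i ≡ suc (suc m) × j ≡ 0)

      data Position (i : ℕ) (u : Fin n) : Set where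
        onPath : i ≤ m → u ≡ g i → Position i u
        atApex : i ≡ suc m → u ≡ y → Position i u

      vertexAt : (i : ℕ) → Dec (i ≤ m) → Fin n
      vertexAt i (yes _) = g i
      vertexAt i (no  _) = y

      positionAt : ∀ i → i < suc (suc m) → (d : Dec (i ≤ m)) → Position i (vertexAt i d)
      positionAt i _     (yes i≤m) = onPath i≤m refl
      positionAt i i<2+m (no  i≰m) = atApex (≤-antisym (≤-pred i<2+m) (≰⇒> i≰m)) refl

      cycle : Fin (suc (suc m)) → Fin n
      cycle x = vertexAt (toℕ x) (toℕ x ≤? m)

      position : ∀ x → Position (toℕ x) (cycle x)
      position x = positionAt (toℕ x) (toℕ<n x) (toℕ x ≤? m)

      apex-adj-ends : i ≤ m → Adj G y (g i) → i ≡ 0 ⊎ i ≡ m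
      apex-adj-ends {zero}  _   _    = inj₁ refl
      apex-adj-ends {suc i} i<m y~gi with m≤n⇒m<n∨m≡n i<m
      ... | inj₁ 1+i<m = contradiction y~gi (y≁inner (suc i) z<s 1+i<m)
      ... | inj₂ 1+i≡m = inj₂ 1+i≡m

      onPath≢apex : i ≤ m → i ≢ suc m
      onPath≢apex i≤m refl = 1+n≰n i≤m

      position-∈ : ∀ {u} → Position i u → u ∈ C
      position-∈ (onPath i≤m refl) = g∈C _ i≤m
      position-∈ (atApex _ refl)   = y∈C

      position-injective : ∀ {u} → Position i u → Position j u → i ≡ j
      position-injective (onPath i≤m refl) (onPath j≤m gi≡gj) =
        inducedPath-injective path i≤m j≤m gi≡gj
      position-injective (onPath i≤m refl) (atApex _ gi≡y)   = contradiction (sym gi≡y) (y∉g _ i≤m)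
      position-injective (atApex _ refl)   (onPath j≤m y≡gj) = contradiction y≡gj (y∉g _ j≤m)
      position-injective (atApex i≡ _)     (atApex j≡ _)     = trans i≡ (sym j≡)

      position-next : ∀ {u u′} → Position i u → Position j u′ → Next i j → Adj G u u′
      position-next (onPath _ refl)   (onPath j≤m refl) (inj₁ refl)      = proj₁ path _ j≤m
      position-next (onPath _ refl)   (atApex refl refl) (inj₁ refl)     = Graph.sym G y~last
      position-next (onPath i≤m _)    _                 (inj₂ (1+i≡ , _)) =
        contradiction (suc-injective 1+i≡) (onPath≢apex i≤m)
      position-next (atApex refl _)   (onPath j≤m _)    (inj₁ refl)      =
        contradiction (≤-trans (n≤1+n _) j≤m) 1+n≰n
      position-next (atApex _ refl)   (onPath _ refl)   (inj₂ (_ , refl)) = y~first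
      position-next (atApex refl _)   (atApex refl _)   (inj₁ ())
      position-next (atApex _ _)      (atApex refl _)   (inj₂ (_ , ()))

      path-apex-adj : ∀ {u u′} → i ≤ m → u ≡ g i → j ≡ suc m → u′ ≡ y → Adj G u u′
                    → Next i j ⊎ Next j i
      path-apex-adj i≤m refl refl refl u~u′ with apex-adj-ends i≤m (Graph.sym G u~u′)
      ... | inj₁ refl = inj₂ (inj₂ (refl , refl))
      ... | inj₂ refl = inj₁ (inj₁ refl)

      position-adj : ∀ {u u′} → Position i u → Position j u′ → Adj G u u′ → Next i j ⊎ Next j i
      position-adj (onPath i≤m refl) (onPath j≤m refl) u~u′ =
        ⊎-map inj₁ inj₁ (inducedPath-adj path i≤m j≤m u~u′)
      position-adj (onPath i≤m u≡) (atApex j≡ u′≡) u~u′ = path-apex-adj i≤m u≡ j≡ u′≡ u~u′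
      position-adj (atApex i≡ u≡) (onPath j≤m u′≡) u~u′ =
        swap (path-apex-adj j≤m u′≡ i≡ u≡ (Graph.sym G u~u′))
      position-adj (atApex _ refl) (atApex _ refl) y~y = contradiction y~y (irrefl G y)

    apex-hole : ChordlessCycleIn G C
    apex-hole =
      suc (suc m) , s≤s (s≤s (distant-ends⇒2≤length (proj₁ path) distant)) , cycle ,
      (λ {x} {x′} cx≡cx′ → toℕ-injective
         (position-injective (position x) (subst (Position (toℕ x′)) (sym cx≡cx′) (position x′)))) ,
      (λ x → position-∈ (position x)) ,
      (λ x x′ → position-next (position x) (position x′)) ,
      (λ x x′ → position-adj (position x) (position x′))

  module _ {W T : Fin n → Set} {s : Fin n} where

    chord⇒shorter : (p : Route Adj⁼ W s T m) → suc i < j → j ≤ m → Adj⁼ (vertex p i) (vertex p j)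
                  → ∃[ m′ ] m′ < m × Route Adj⁼ W s T m′
    chord⇒shorter {i = i} p 1+i<j j≤m chord
      with m≤n⇒∃[o]m+o≡n 1+i<j | m≤n⇒∃[o]m+o≡n j≤m
    ... | e , refl | r , refl =
      suc i + r , subst (suc i + r <_) (sym length≡) (m<m+n (suc i + r) z<s) ,
      Route-bypass p length≡ (subst (Adj⁼ (vertex p i) ∘ vertex p) (sym (+-suc (suc i) e)) chord)
      where
      length≡ : suc (suc i) + e + r ≡ suc i + r + suc e
      length≡ = trans (cong (_+ r) (sym (+-suc (suc i) e))) (xy∙z≈xz∙y (suc i) (suc e) r)

    -- A step that repeats a vertex is either the last one (then T is hit earlier) or
    -- it is followed by a step that gives a chord.
    lazy-steps⇒steps : (p : Route Adj⁼ W s T m) → Chordless (vertex p) m → Avoids T (vertex p) m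
                     → Steps (Adj G) (vertex p) m
    lazy-steps⇒steps p chordless avoids k k<m with steps p k k<m
    ... | inj₂ adj = adj
    ... | inj₁ same with m≤n⇒m<n∨m≡n k<m
    ...   | inj₁ 2+k≤m = contradiction
              (subst (λ u → Adj⁼ u (vertex p (suc (suc k)))) (sym same) (steps p (suc k) 2+k≤m))
              (chordless k (suc (suc k)) ≤-refl 2+k≤m)
    ...   | inj₂ refl = contradiction (subst T (sym same) (target p)) (avoids k k<m)

    -- A shortest route is induced and meets T only at its end; the recursion on the
    -- length lets us assume that no shorter route exists.
    no-inducedRoute⇒no-route :
        (∀ {m} (p : Route (Adj G) W s T m) → Chordless (vertex p) m → Avoids T (vertex p) m → ⊥)
      → Route (Adj G) W s T m → ⊥
    no-inducedRoute⇒no-route no-induced p =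
      <-rec (λ m → Route Adj⁼ W s T m → ⊥) shortest _ (Route-map inj₂ p)
      where
      shortest : ∀ m → (∀ {m′} → m′ < m → Route Adj⁼ W s T m′ → ⊥) → Route Adj⁼ W s T m → ⊥
      shortest m shorter q = no-induced strict chordless avoids
        where
        avoids : Avoids T (vertex q) m
        avoids i i<m i∈T = shorter i<m (Route-prefix q (<⇒≤ i<m) i∈T)

        chordless : Chordless (vertex q) m
        chordless i j 1+i<j j≤m chord with chord⇒shorter q 1+i<j j≤m chord
        ... | _ , m′<m , q′ = shorter m′<m q′

        strict : Route (Adj G) W s T m
        strict = record
          { vertex = vertex q ; source = source q ; target = target q ; inside = inside q
          ; steps = lazy-steps⇒steps q chordless avoids }

  walkIn-head : ∀ {W x y} → WalkIn G W x y → W x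
  walkIn-head (here x∈W)     = x∈W
  walkIn-head (step x∈W _ _) = x∈W

  walkIn-mono : ∀ {P Q : Fin n → Set} {x y} → (∀ {u} → P u → Q u)
              → WalkIn G P x y → WalkIn G Q x y
  walkIn-mono P⊆Q (here x∈P)         = here (P⊆Q x∈P)
  walkIn-mono P⊆Q (step x∈P x~ rest) = step (P⊆Q x∈P) x~ (walkIn-mono P⊆Q rest)

  walkIn-closed : ∀ {W P : Fin n → Set} {x y} → (∀ u u′ → P u → W u′ → Adj G u u′ → P u′)
                → P x → WalkIn G W x y → WalkIn G P x y
  walkIn-closed closed x∈P (here _)         = here x∈P
  walkIn-closed closed x∈P (step _ x~ rest) =
    step x∈P x~ (walkIn-closed closed (closed _ _ x∈P (walkIn-head rest) x~) rest)

  component-walkIn : ∀ {W C x y} → IsComponent G W C → x ∈ C → y ∈ C → WalkIn G (_∈ C) x y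
  component-walkIn (_ , _ , connected , closed) x∈C y∈C =
    walkIn-closed closed x∈C (connected _ _ x∈C y∈C)

  walkIn⇒route : ∀ {W T s t} → T t → WalkIn G W s t → ∃[ m ] Route (Adj G) W s T m
  walkIn⇒route {s = s} t∈T (here s∈W) = 0 , record
    { vertex = λ _ → s ; source = refl ; target = t∈T ; inside = λ _ _ → s∈W ; steps = λ _ () }
  walkIn⇒route t∈T (step s∈W s~ rest) with walkIn⇒route t∈T rest
  ... | m , p = suc m , Route-cons s∈W s~ p

module ComponentOfH {n : ℕ} (G : Graph n) {v : Fin n} {B I A : Subset n} {z : Fin n}
  (v∉B : v ∉ B) (chordal : ChordalMinus G B) (independent : Independent G I)
  (v~I : ∀ x → x ∈ I → Adj G v x) (component : IsComponent G (Hset G v B I) A)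
  (z∈I : z ∈ I) (z∈A : z ∈ A) where

  A⊆H : ∀ {u} → u ∈ A → Hset G v B I u
  A⊆H = proj₁ (proj₂ component) _

  A-closed : ∀ {a u} → a ∈ A → Hset G v B I u → Adj G a u → u ∈ A
  A-closed = proj₂ (proj₂ (proj₂ component)) _ _

  A⊆∁B∖v : ∀ {u} → u ∈ A → u ∉ B × u ≢ v
  A⊆∁B∖v u∈A = proj₁ (proj₂ (A⊆H u∈A)) , proj₁ (A⊆H u∈A)

  A∩N[v]⊆I : ∀ {u} → u ∈ A → Adj G v u → u ∈ I
  A∩N[v]⊆I {u} u∈A v~u with A⊆H u∈A
  ... | _ , u∉B , u∉X = decidable-stable (u ∈? I) (λ u∉I → u∉X (v~u , u∉B , u∉I))

  no-hole-through-v : ∀ {g m} → InducedPath G g m → ¬ Adj⁼ G (g 0) (g m)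
    → Within (λ u → u ∉ B × u ≢ v) g m → Adj G v (g 0) → Adj G v (g m)
    → (∀ i → 0 < i → i < m → ¬ Adj G v (g i)) → ⊥
  no-hole-through-v path distant g∉B v~first v~last v≁inner = chordal
    (apex-hole G path distant (λ i i≤m → x∉p⇒x∈∁p (proj₁ (g∉B i i≤m))) (x∉p⇒x∈∁p v∉B)
       (λ i i≤m → proj₂ (g∉B i i≤m) ∘ sym) v~first v~last v≁inner)

  inner≢first : ∀ {g m i} → InducedPath G g m → 0 < i → i < m → g i ≢ g 0
  inner≢first path 0<i i<m gi≡g0 =
    <⇒≢ 0<i (sym (inducedPath-injective G path (<⇒≤ i<m) z≤n gi≡g0))

  I∩A⊆⁅z⁆ : ∀ {x} → x ∈ I → x ∈ A → x ≡ z
  I∩A⊆⁅z⁆ {x} x∈I x∈A = decidable-stable (x ≟ᶠ z) λ x≢z →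
    no-inducedRoute⇒no-route G hole
      (proj₂ (walkIn⇒route G (x∈I , x≢z) (component-walkIn G component z∈A x∈A)))
    where
    hole : ∀ {m} (p : Route (Adj G) (_∈ A) z (λ u → u ∈ I × u ≢ z) m)
         → Chordless G (vertex p) m → Avoids (λ u → u ∈ I × u ≢ z) (vertex p) m → ⊥
    hole {m} p chordless avoids = no-hole-through-v path distant (λ i → A⊆∁B∖v ∘ inside p i)
      (subst (Adj G v) (sym (source p)) (v~I z z∈I)) (v~I _ (proj₁ (target p))) v≁inner
      where
      path : InducedPath G (vertex p) m
      path = steps p , chordless
      distant : ¬ Adj⁼ G (vertex p 0) (vertex p m)
      distant (inj₁ first≡last) = proj₂ (target p) (trans (sym first≡last) (source p))
      distant (inj₂ first~last) =
        independent _ _ (subst (_∈ I) (sym (source p)) z∈I) (proj₁ (target p)) first~last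
      v≁inner : ∀ i → 0 < i → i < m → ¬ Adj G v (vertex p i)
      v≁inner i 0<i i<m v~gi = avoids i i<m
        ( A∩N[v]⊆I (inside p i (<⇒≤ i<m)) v~gi
        , λ gi≡z → inner≢first path 0<i i<m (trans gi≡z (sym (source p))) )

  N[v]∩N[A]⊆N[z] : ∀ {a w} → a ∈ A → Adj G a w → w ∉ A → w ∉ B → Adj G v w → Adj G z w
  N[v]∩N[A]⊆N[z] {a} {w} a∈A a~w w∉A w∉B v~w = decidable-stable (adj? G z w) λ z≁w →
    no-inducedRoute⇒no-route G (hole z≁w) (proj₂ (walkIn⇒route G refl walk))
    where
    W : Fin n → Set
    W u = u ≡ w ⊎ u ∈ A

    walk : WalkIn G W w z
    walk = step (inj₁ refl) (Graph.sym G a~w)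
                (walkIn-mono G inj₂ (component-walkIn G component a∈A z∈A))

    hole : ¬ Adj G z w → ∀ {m} (p : Route (Adj G) W w (_≡ z) m)
         → Chordless G (vertex p) m → Avoids (_≡ z) (vertex p) m → ⊥
    hole z≁w {m} p chordless avoids = no-hole-through-v path distant (λ i → W⊆∁B∖v ∘ inside p i)
      (subst (Adj G v) (sym (source p)) v~w) (subst (Adj G v) (sym (target p)) (v~I z z∈I)) v≁inner
      where
      path : InducedPath G (vertex p) m
      path = steps p , chordless
      W⊆∁B∖v : ∀ {u} → W u → u ∉ B × u ≢ v
      W⊆∁B∖v (inj₁ refl) = w∉B , λ { refl → irrefl G v v~w }
      W⊆∁B∖v (inj₂ u∈A)  = A⊆∁B∖v u∈A
      distant : ¬ Adj⁼ G (vertex p 0) (vertex p m)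
      distant (inj₁ first≡last) =
        w∉A (subst (_∈ A) (trans (sym (target p)) (trans (sym first≡last) (source p))) z∈A)
      distant (inj₂ first~last) = z≁w (Graph.sym G (subst₂ (Adj G) (source p) (target p) first~last))
      v≁inner : ∀ i → 0 < i → i < m → ¬ Adj G v (vertex p i)
      v≁inner i 0<i i<m v~gi with inside p i (<⇒≤ i<m)
      ... | inj₁ gi≡w  = inner≢first path 0<i i<m (trans gi≡w (sym (source p)))
      ... | inj₂ gi∈A = avoids i i<m (I∩A⊆⁅z⁆ (A∩N[v]⊆I gi∈A v~gi) gi∈A)

lemma3p10 : {n : ℕ} (G : Graph n) (EI EM : Fin n → Fin n → Set)
    → (∀ u w → EI u w → Adj G u w) → (∀ u w → EM u w → Adj G u w)
    → (v : Fin n) (B : Subset n) → v ∉ B → ChordalMinus G B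
    → (I : Subset n) → Independent G I
    → (∀ x → x ∈ I → NR G EI EM v x × x ∉ B)
    → (A : Subset n) → IsComponent G (Hset G v B I) A
    → (z : Fin n) → z ∈ I → z ∈ A
    → (∀ b → ¬ HatEdge G v B z A b)
    → ∀ w → ((NbhdSet G A w × w ∉ A → Adj G z w × w ∉ A)
    × (Adj G z w × w ∉ A → NbhdSet G A w × w ∉ A))
lemma3p10 G _ _ _ _ v B v∉B chordal I independent I⊆NR A component z z∈I z∈A isolated w =
  (λ { (N[A]∋w , w∉A) → decidable-stable (adj? G z w) (¬¬z~w N[A]∋w w∉A) , w∉A })
  , λ { (z~w , w∉A) → (z , z∈A , z~w) , w∉A }
  where
  v~I : ∀ x → x ∈ I → Adj G v x
  v~I x x∈I = proj₁ (proj₁ (I⊆NR x x∈I))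

  open ComponentOfH G v∉B chordal independent v~I component z∈I z∈A

  ¬¬z~w : NbhdSet G A w → w ∉ A → ¬ ¬ Adj G z w
  ¬¬z~w N[A]∋w@(a , a∈A , a~w) w∉A z≁w = w∉A (A-closed a∈A (w≢v , w∉B , w∉X) a~w)
    where
    w≢v : w ≢ v
    w≢v refl = z≁w (Graph.sym G (v~I z z∈I))
    w∉B : w ∉ B
    w∉B w∈B = isolated w (inj₂ (w∈B , w∉N[v] , N[A]∋w))
      where
      w∉N[v] : ¬ Adj G v w
      w∉N[v] v~w = isolated w (inj₁ (w∈B , v~w , N[A]∋w , z≁w))
    w∉X : ¬ Xset G v B I w
    w∉X (v~w , _ , _) = z≁w (N[v]∩N[A]⊆N[z] a∈A a~w w∉A w∉B v~w)
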